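{- Let $\ell\ge3$ and let $\lambda$ be an $\ell$-regular partition (a node of $B(\Lambda_0)$). Then for every residue $0\le i<\ell$ there do not exist positions $(a,b)$ and $(c,d)$ on the same $i$-ladder such that $(a,b)$ is an addable box of $\lambda$, $(c,d)$ is a removable box of $\lambda$, and $a<c$.
   Context: An $\ell$-regular partition has no nonzero part repeated $\ell$ or more times. Young diagrams in English notation; $(a,b)$ is the position in row $a$, column $b$, residue $b-a\bmod\ell$. A removable box is a box of $\lambda$ whose removal leaves a partition; an addable box is a position not in $\lambda$ whose addition gives a partition. The ladder of $(a,b)$ is the set of positions $(c,d)$, $c,d\ge1$, with $c+(\ell-1)d=a+(\ell-1)b$; all its positions have the same residue, and an $i$-ladder is a ladder of residue $i$. -}

module Defs where

open import Data.Nat using (ℕ; zero; suc; _+_; _*_; _∸_; _≤_; _<_; _≥_; _≟_)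
open import Data.List using (List; []; _∷_; filter; length)
open import Data.List.Relation.Unary.All using (All)
open import Data.List.Relation.Unary.Linked using (Linked)
open import Data.Product using (_×_; ∃)
open import Data.Sum using (_⊎_)
open import Relation.Binary.PropositionalEquality using (_≡_)
open import Relation.Nullary using (¬_)

IsPartition : List ℕ → Set
IsPartition μ = Linked _≥_ μ × All (λ x → 0 < x) μ

-- 1-indexed part: part μ a = μ_a (0 beyond the length; index 0 unused).
part : List ℕ → ℕ → ℕ
part [] _ = 0
part (x ∷ xs) zero = 0
part (x ∷ xs) (suc zero) = x
part (x ∷ xs) (suc (suc n)) = part xs (suc n)

Regular : ℕ → List ℕ → Set
Regular ℓ μ = ∀ k → 0 < k → length (filter (_≟ k) μ) < ℓ

-- (a,b) is a box of the Young diagram of μ (row a, column b, English notation).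
InDiagram : List ℕ → ℕ → ℕ → Set
InDiagram μ a b = 1 ≤ a × 1 ≤ b × b ≤ part μ a

Removable : List ℕ → ℕ → ℕ → Set
Removable μ a b = InDiagram μ a b × ¬ InDiagram μ (suc a) b × ¬ InDiagram μ a (suc b)

-- Addable box: a position not in μ whose addition gives a partition
-- (the positions directly above and to the left are boxes of μ, or off the diagram edge).
Addable : List ℕ → ℕ → ℕ → Set
Addable μ a b = 1 ≤ a × 1 ≤ b × ¬ InDiagram μ a b
              × (a ≡ 1 ⊎ InDiagram μ (a ∸ 1) b)
              × (b ≡ 1 ⊎ InDiagram μ a (b ∸ 1))

SameLadder : ℕ → ℕ → ℕ → ℕ → ℕ → Set
SameLadder ℓ a b c d = c + (ℓ ∸ 1) * d ≡ a + (ℓ ∸ 1) * b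

-- Residue of (a,b) is i (0 ≤ i < ℓ): i ≡ b - a (mod ℓ), written without subtraction
-- as  b + (ℓ-1)a ≡ i + qℓ  for some q  (since -a ≡ (ℓ-1)a mod ℓ).
HasResidue : ℕ → ℕ → ℕ → ℕ → Set
HasResidue ℓ a b i = i < ℓ × ∃ λ q → b + (ℓ ∸ 1) * a ≡ i + q * ℓ

module Submission where

-- Write ℓ = m + 1, so the ladder condition reads  c + m·d = a + m·b.
-- If (a,b) is addable, (c,d) removable and a < c, then d < b; writing
-- b = d + (k+1) gives c = a + m(k+1).  Along the rows a, a+m, …, a+m(k+1) = c
-- the parts fall in total by at most
--     λ_a − λ_c  ≤  (b − 1) − d  =  k,
-- since λ_a < b (the box (a,b) is missing) and d ≤ λ_c.  These are k+1
-- windows of m steps, so the parts cannot fall in all of them: some window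
-- [y, y+m] of m+1 = ℓ consecutive rows has constant parts, all ≥ λ_c ≥ d ≥ 1.
-- That is a nonzero part repeated ℓ times, contradicting ℓ-regularity.

open import Defs
open import Data.Nat using (ℕ; _≤_; _<_; _≥_; zero; suc; _+_; _*_; z≤n; s≤s; _≟_; _≤?_)
open import Data.Nat.Properties
open import Data.List using (List; []; _∷_; filter; length)
open import Data.List.Properties using (filter-accept; filter-reject)
open import Data.List.Relation.Unary.Linked using (Linked; _∷_)
open import Data.Product using (_×_; ∃-syntax; _,_)
open import Data.Empty using (⊥-elim)
open import Relation.Nullary using (¬_; yes; no)
open import Relation.Binary.PropositionalEquality

Antitone : (ℕ → ℕ) → Set
Antitone p = ∀ {i j} → i ≤ j → p j ≤ p i

-- The parts of a partition, indexed from 0: row r of the diagram is row (r+1).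
row : List ℕ → ℕ → ℕ
row μ r = part μ (suc r)

row-step : ∀ μ → Linked _≥_ μ → ∀ r → row μ (suc r) ≤ row μ r
row-step []           _       r       = z≤n
row-step (x ∷ [])     _       r       = z≤n
row-step (x ∷ y ∷ ys) (x≥y ∷ _) zero    = x≥y
row-step (x ∷ y ∷ ys) (_ ∷ L) (suc r) = row-step (y ∷ ys) L r

row-antitone : ∀ μ → Linked _≥_ μ → Antitone (row μ)
row-antitone μ L {i} i≤j with m≤n⇒∃[o]m+o≡n i≤j
... | k , refl = descend k
  where
  descend : ∀ k → row μ (i + k) ≤ row μ i
  descend zero    rewrite +-identityʳ i = ≤-refl
  descend (suc k) rewrite +-suc i k     = ≤-trans (row-step μ L (i + k)) (descend k)

window-shift : ∀ x m k → x + m * suc (suc k) ≡ (x + m) + m * suc k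
window-shift x m k = trans (cong (x +_) (*-suc m (suc k))) (sym (+-assoc x m (m * suc k)))

-- Pigeonhole on falls: if an antitone p falls by at most k over the k+1
-- windows [x, x+m], [x+m, x+2m], …, then one window [y, y+m] is flat, and it
-- lies above the final row x + m(k+1).
flat-window : ∀ {p} → Antitone p → ∀ m k x →
              p x ≤ p (x + m * suc k) + k →
              ∃[ y ] p (x + m * suc k) ≤ p (y + m) × p y ≤ p (y + m)
flat-window {p} anti m k x fall with p x ≤? p (x + m)
... | yes flat = x , anti (+-monoʳ-≤ x (m≤m*n m (suc k))) , flat
flat-window {p} anti m zero x fall | no drops =
  ⊥-elim (drops (subst (p x ≤_) lastRow fall))
  where
  lastRow : p (x + m * 1) + 0 ≡ p (x + m)
  lastRow = trans (+-identityʳ _) (cong (λ n → p (x + n)) (*-identityʳ m))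
flat-window {p} anti m (suc k) x fall | no drops
  with flat-window anti m k (x + m) fallRest
  where
  restart : p (x + m * suc (suc k)) + suc k ≡ suc (p ((x + m) + m * suc k) + k)
  restart = trans (cong (λ n → p n + suc k) (window-shift x m k)) (+-suc _ k)
  -- The first window falls by at least one, leaving at most k for the rest.
  fallRest : p (x + m) ≤ p ((x + m) + m * suc k) + k
  fallRest = ≤-pred (≤-trans (≰⇒> drops) (subst (p x ≤_) restart fall))
... | y , below , flat =
  y , subst (λ n → p n ≤ p (y + m)) (sym (window-shift x m k)) below , flat

window-constant : ∀ {p} → Antitone p → ∀ y m → p y ≤ p (y + m) →
                  ∀ j → j ≤ m → p (y + j) ≡ p y
window-constant anti y m flat j j≤m =
  ≤-antisym (anti (m≤m+n y j)) (≤-trans flat (anti (+-monoʳ-≤ y j≤m)))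

count-cons : ∀ v x xs → length (filter (_≟ v) xs) ≤ length (filter (_≟ v) (x ∷ xs))
count-cons v x xs with x ≟ v
... | yes x≡v rewrite filter-accept (_≟ v) {x} {xs} x≡v = n≤1+n _
... | no  x≢v rewrite filter-reject (_≟ v) {x} {xs} x≢v = ≤-refl

repeated-part : ∀ μ r n v → 0 < v → (∀ j → j ≤ n → row μ (r + j) ≡ v) →
                n < length (filter (_≟ v) μ)
repeated-part []       r       n v v>0 same with same 0 z≤n
... | refl = ⊥-elim (<-irrefl refl v>0)
repeated-part (x ∷ xs) (suc r) n v v>0 same =
  ≤-trans (repeated-part xs r n v v>0 same) (count-cons v x xs)
repeated-part (x ∷ xs) zero    n v v>0 same with x ≟ v
... | no  x≢v = ⊥-elim (x≢v (same 0 z≤n))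
... | yes x≡v rewrite filter-accept (_≟ v) {x} {xs} x≡v with n
...   | zero   = s≤s z≤n
...   | suc n′ = s≤s (repeated-part xs zero n′ v v>0 (λ j j≤n′ → same (suc j) (s≤s j≤n′)))

ladder-column : ∀ m a b c d → c + m * d ≡ a + m * b → a < c → d < b
ladder-column m a b c d ladder a<c =
  ≰⇒> (λ b≤d → <⇒≢ (+-mono-<-≤ a<c (*-monoʳ-≤ m b≤d)) (sym ladder))

ladder-offset : ∀ m a b c d → c + m * d ≡ a + m * b → a < c →
                ∃[ k ] b ≡ d + suc k × c ≡ a + m * suc k
ladder-offset m a b c d ladder a<c
  with m≤n⇒∃[o]m+o≡n (ladder-column m a b c d ladder a<c)
... | k , refl = k , sym (+-suc d k) , c≡
  where
  open ≡-Reasoning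
  c≡ : c ≡ a + m * suc k
  c≡ = +-cancelʳ-≡ (m * d) c (a + m * suc k) (begin
    c + m * d                ≡⟨ ladder ⟩
    a + m * (suc d + k)      ≡⟨ cong (λ n → a + m * n) (sym (+-suc d k)) ⟩
    a + m * (d + suc k)      ≡⟨ cong (a +_) (*-distribˡ-+ m d (suc k)) ⟩
    a + (m * d + m * suc k)  ≡⟨ cong (a +_) (+-comm (m * d) _) ⟩
    a + (m * suc k + m * d)  ≡⟨ sym (+-assoc a _ _) ⟩
    a + m * suc k + m * d    ∎)

lemma9p2 : (ℓ : ℕ) → 3 ≤ ℓ → (μ : List ℕ) → IsPartition μ → Regular ℓ μ →
    (i : ℕ) → i < ℓ →
    ¬ (∃[ a ] ∃[ b ] ∃[ c ] ∃[ d ]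
         (HasResidue ℓ a b i × SameLadder ℓ a b c d ×
          Addable μ a b × Removable μ c d × a < c))
lemma9p2 (suc m) _ μ (decreasing , _) regular _ _
  (suc a , b , c , d , _ , ladder , (_ , b≥1 , notBox , _ , _) , ((_ , d≥1 , d≤λc) , _ , _) , a<c)
  with ladder-offset m (suc a) b c d ladder a<c
-- Now b = d + (k+1) and c = a + m(k+1) (rows counted from 0 via  row).
... | k , refl , refl
  with flat-window (row-antitone μ decreasing) m k a smallFall
  where
  -- The total fall is at most k:  λ_a < b = d + k + 1 ≤ λ_c + k + 1.
  smallFall : row μ a ≤ row μ (a + m * suc k) + k
  smallFall = ≤-pred (≤-trans (≰⇒> (λ b≤λa → notBox (s≤s z≤n , b≥1 , b≤λa)))
                       (subst (_≤ suc (row μ (a + m * suc k) + k)) (sym (+-suc d k))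
                              (s≤s (+-monoˡ-≤ k d≤λc))))
-- The flat window [y, y+m] gives ℓ = m+1 equal nonzero parts.
... | y , below , flat =
  <⇒≱ (regular (row μ y) positive)
      (repeated-part μ y m (row μ y) positive
         (window-constant (row-antitone μ decreasing) y m flat))
  where
  -- The window's part is at least λ_c ≥ d ≥ 1.
  positive : 0 < row μ y
  positive = ≤-trans d≥1 (≤-trans d≤λc
               (≤-trans below (row-antitone μ decreasing (m≤m+n y m))))
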